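{- Let $\mathbf{D}$ be a dagger kernel category. Then $\mathbf{D}$ is Boolean if and only if for all kernels $m\colon M\to X$, $n\colon N\to X$ and every pullback square $m\circ q=n\circ p$ of $m$ and $n$, with $p\colon P\to N$ and $q\colon P\to M$ (which are kernels, represented by dagger monos), one has $n^\dagger\circ m=p\circ q^\dagger$.
   Context: A dagger category is a category with a contravariant functor $\dagger$ that is the identity on objects with $f^{\dagger\dagger}=f$; $f$ is a dagger mono if $f^\dagger\circ f=\mathrm{id}$. A dagger kernel category is a dagger category with a zero object $0$ in which every morphism $f$ has a kernel (universal $k$ with $f\circ k=0$) that can be chosen to be a dagger mono; by convention kernels are always represented by dagger monos. Pullbacks of kernels along kernels exist and their legs are kernels. Meets $m\wedge n$ of kernels with common codomain are given by pullback. The dagger kernel category is Boolean if for all kernels $m,n$ with common codomain, $m\wedge n=0$ implies $m^\dagger\circ n=0$. -}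

module Defs where

open import Level using (Level; _⊔_; suc)
open import Data.Product using (Σ; Σ-syntax; _×_; _,_)
open import Relation.Binary.PropositionalEquality using (_≡_)

record Category (o ℓ : Level) : Set (suc (o ⊔ ℓ)) where
  infixr 9 _∘_
  field
    Obj  : Set o
    Hom  : Obj → Obj → Set ℓ
    id   : ∀ {A} → Hom A A
    _∘_  : ∀ {A B C} → Hom B C → Hom A B → Hom A C
    assoc     : ∀ {A B C D} (h : Hom C D) (g : Hom B C) (f : Hom A B) →
                (h ∘ g) ∘ f ≡ h ∘ (g ∘ f)
    identityˡ : ∀ {A B} (f : Hom A B) → id ∘ f ≡ f
    identityʳ : ∀ {A B} (f : Hom A B) → f ∘ id ≡ f

record DaggerCategory (o ℓ : Level) : Set (suc (o ⊔ ℓ)) where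
  field
    cat : Category o ℓ
  open Category cat public
  field
    _† : ∀ {A B} → Hom A B → Hom B A
    †-id       : ∀ {A} → (id {A}) † ≡ id
    †-homo     : ∀ {A B C} (g : Hom B C) (f : Hom A B) → (g ∘ f) † ≡ (f †) ∘ (g †)
    †-involutive : ∀ {A B} (f : Hom A B) → (f †) † ≡ f

  IsDaggerMono : ∀ {A B} → Hom A B → Set ℓ
  IsDaggerMono f = (f †) ∘ f ≡ id

record DaggerCategoryWithZero (o ℓ : Level) : Set (suc (o ⊔ ℓ)) where
  field
    dagger : DaggerCategory o ℓ
  open DaggerCategory dagger public
  field
    𝟎 : Obj
    ¡       : ∀ {A} → Hom 𝟎 A
    ¡-unique : ∀ {A} (f : Hom 𝟎 A) → f ≡ ¡
    !       : ∀ {A} → Hom A 𝟎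
    !-unique : ∀ {A} (f : Hom A 𝟎) → f ≡ !

  zero : ∀ {A B} → Hom A B
  zero = ¡ ∘ !

  IsZeroObject : Obj → Set (o ⊔ ℓ)
  IsZeroObject P =
    (∀ {A} → Σ[ u ∈ Hom P A ] (∀ (f : Hom P A) → f ≡ u)) ×
    (∀ {A} → Σ[ u ∈ Hom A P ] (∀ (f : Hom A P) → f ≡ u))

  IsKernelOf : ∀ {K X Y} → Hom K X → Hom X Y → Set (o ⊔ ℓ)
  IsKernelOf {K} {X} {Y} k f =
    (f ∘ k ≡ zero) ×
    (∀ {Z} (g : Hom Z X) → f ∘ g ≡ zero →
       Σ[ h ∈ Hom Z K ] ((k ∘ h ≡ g) × (∀ (h' : Hom Z K) → k ∘ h' ≡ g → h' ≡ h)))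

  IsKernel : ∀ {M X} → Hom M X → Set (o ⊔ ℓ)
  IsKernel {M} {X} m = IsDaggerMono m × Σ[ Y ∈ Obj ] Σ[ f ∈ Hom X Y ] IsKernelOf m f

  IsPullback : ∀ {P M N X} (m : Hom M X) (n : Hom N X) (q : Hom P M) (p : Hom P N) →
               Set (o ⊔ ℓ)
  IsPullback {P} {M} {N} {X} m n q p =
    (m ∘ q ≡ n ∘ p) ×
    (∀ {Z} (a : Hom Z M) (b : Hom Z N) → m ∘ a ≡ n ∘ b →
       Σ[ h ∈ Hom Z P ] ((q ∘ h ≡ a) × (p ∘ h ≡ b) ×
         (∀ (h' : Hom Z P) → q ∘ h' ≡ a → p ∘ h' ≡ b → h' ≡ h)))

record DaggerKernelCategory (o ℓ : Level) : Set (suc (o ⊔ ℓ)) where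
  field
    base : DaggerCategoryWithZero o ℓ
  open DaggerCategoryWithZero base public
  field
    ker      : ∀ {X Y} → Hom X Y → Obj
    kerArrow : ∀ {X Y} (f : Hom X Y) → Hom (ker f) X
    ker-isKernel    : ∀ {X Y} (f : Hom X Y) → IsKernelOf (kerArrow f) f
    ker-daggerMono  : ∀ {X Y} (f : Hom X Y) → IsDaggerMono (kerArrow f)

module _ {o ℓ : Level} (D : DaggerKernelCategory o ℓ) where
  open DaggerKernelCategory D

  -- Boolean: for kernels m, n with common codomain, m ∧ n = 0 implies m† ∘ n = 0.
  -- The meet m ∧ n is given by a pullback (with kernel legs); m ∧ n = 0 means
  -- its domain P is a zero object.
  IsBoolean : Set (o ⊔ ℓ)
  IsBoolean =
    ∀ {P M N X} (m : Hom M X) (n : Hom N X) (q : Hom P M) (p : Hom P N) →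
    IsKernel m → IsKernel n → IsKernel q → IsKernel p →
    IsPullback m n q p → IsZeroObject P → (m †) ∘ n ≡ zero

  PullbackDaggerProperty : Set (o ⊔ ℓ)
  PullbackDaggerProperty =
    ∀ {P M N X} (m : Hom M X) (n : Hom N X) (q : Hom P M) (p : Hom P N) →
    IsKernel m → IsKernel n → IsKernel q → IsKernel p →
    IsPullback m n q p → (n †) ∘ m ≡ p ∘ (q †)

-- Backward: if the meet P of m and n is a zero object then p ∘ q† factors
-- through P, hence vanishes, so n† ∘ m = 0 and, taking daggers, m† ∘ n = 0.
--
-- Forward: let r = ker (q†) be the orthocomplement of q inside M.  Kernels are
-- closed under composition, so m ∘ r is a kernel, and since r is orthogonal to
-- the meet q, the meet of m ∘ r and n is 0.  Booleanness gives
-- r† ∘ m† ∘ n = 0, i.e. m† ∘ n is annihilated by the orthocomplement of q;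
-- as the kernel q is "closed" (the kernel of its own orthocomplement's
-- dagger), m† ∘ n = q ∘ q† ∘ m† ∘ n.  Taking daggers and using m ∘ q = n ∘ p
-- yields n† ∘ m = n† ∘ n ∘ p ∘ q† = p ∘ q†.
module Submission where

open import Defs
open import Level using (Level; _⊔_)
open import Function.Bundles using (_⇔_; mk⇔)
open import Data.Product using (Σ; Σ-syntax; _×_; _,_; proj₁; proj₂)
open import Relation.Binary.PropositionalEquality

module KernelFacts {o ℓ : Level} (D : DaggerKernelCategory o ℓ) where
  open DaggerKernelCategory D
  open ≡-Reasoning

  ∘-zeroʳ : ∀ {A B C} (f : Hom B C) → f ∘ zero {A} {B} ≡ zero
  ∘-zeroʳ f = trans (sym (assoc f ¡ !)) (cong (_∘ !) (¡-unique (f ∘ ¡)))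

  ∘-zeroˡ : ∀ {A B C} (f : Hom A B) → zero {B} {C} ∘ f ≡ zero
  ∘-zeroˡ f = trans (assoc ¡ ! f) (cong (¡ ∘_) (!-unique (! ∘ f)))

  zero-† : ∀ {A B} → (zero {A} {B}) † ≡ zero
  zero-† = trans (†-homo ¡ !) (cong₂ _∘_ (¡-unique (! †)) (!-unique (¡ †)))

  †-swap : ∀ {A B C} (g : Hom C B) (f : Hom A B) → ((g †) ∘ f) † ≡ (f †) ∘ g
  †-swap g f = trans (†-homo (g †) f) (cong ((f †) ∘_) (†-involutive g))

  †-zero : ∀ {A B C} (g : Hom C B) (f : Hom A B) → (g †) ∘ f ≡ zero → (f †) ∘ g ≡ zero
  †-zero g f e = trans (sym (†-swap g f)) (trans (cong _† e) zero-†)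

  dagger-retract : ∀ {K X Z} {k : Hom K X} → IsDaggerMono k → (a : Hom Z K) →
                   (k †) ∘ (k ∘ a) ≡ a
  dagger-retract {k = k} dm a = begin
    (k †) ∘ (k ∘ a) ≡⟨ sym (assoc _ _ _) ⟩
    ((k †) ∘ k) ∘ a ≡⟨ cong (_∘ a) dm ⟩
    id ∘ a          ≡⟨ identityˡ a ⟩
    a               ∎

  dagger-mono-cancel : ∀ {K X Z} {k : Hom K X} → IsDaggerMono k → (a b : Hom Z K) →
                       k ∘ a ≡ k ∘ b → a ≡ b
  dagger-mono-cancel {k = k} dm a b e = begin
    a               ≡⟨ sym (dagger-retract dm a) ⟩
    (k †) ∘ (k ∘ a) ≡⟨ cong ((k †) ∘_) e ⟩
    (k †) ∘ (k ∘ b) ≡⟨ dagger-retract dm b ⟩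
    b               ∎

  dagger-mono-∘ : ∀ {A B C} {k : Hom B C} {l : Hom A B} →
                  IsDaggerMono k → IsDaggerMono l → IsDaggerMono (k ∘ l)
  dagger-mono-∘ {k = k} {l} dk dl = begin
    ((k ∘ l) †) ∘ (k ∘ l)     ≡⟨ cong (_∘ (k ∘ l)) (†-homo k l) ⟩
    ((l †) ∘ (k †)) ∘ (k ∘ l) ≡⟨ assoc _ _ _ ⟩
    (l †) ∘ ((k †) ∘ (k ∘ l)) ≡⟨ cong ((l †) ∘_) (dagger-retract dk l) ⟩
    (l †) ∘ l                 ≡⟨ dl ⟩
    id                        ∎

  annihilate-factor : ∀ {A S T Z} (s : Hom S A) (u : Hom T S) (x : Hom Z A) →
                      (s †) ∘ x ≡ zero → ((s ∘ u) †) ∘ x ≡ zero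
  annihilate-factor s u x e = begin
    ((s ∘ u) †) ∘ x         ≡⟨ cong (_∘ x) (†-homo s u) ⟩
    ((u †) ∘ (s †)) ∘ x     ≡⟨ assoc _ _ _ ⟩
    (u †) ∘ ((s †) ∘ x)     ≡⟨ cong ((u †) ∘_) e ⟩
    (u †) ∘ zero            ≡⟨ ∘-zeroʳ _ ⟩
    zero                    ∎

  annihilate-through : ∀ {A S T Z} {s : Hom S A} {t : Hom T A} →
                       Σ[ u ∈ Hom T S ] (s ∘ u ≡ t) → (x : Hom Z A) →
                       (s †) ∘ x ≡ zero → (t †) ∘ x ≡ zero
  annihilate-through {s = s} (u , su) x e =
    subst (λ w → (w †) ∘ x ≡ zero) su (annihilate-factor s u x e)

  kernel-factor : ∀ {K X Y Z} {k : Hom K X} {f : Hom X Y} → IsKernelOf k f →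
                  (g : Hom Z X) → f ∘ g ≡ zero → Σ[ h ∈ Hom Z K ] (k ∘ h ≡ g)
  kernel-factor (_ , univ) g e = proj₁ (univ g e) , proj₁ (proj₂ (univ g e))

  kerArrow-isKernel : ∀ {X Y} (f : Hom X Y) → IsKernel (kerArrow f)
  kerArrow-isKernel f = ker-daggerMono f , _ , f , ker-isKernel f

  orth : ∀ {K X} (k : Hom K X) → Hom (ker (k †)) X
  orth k = kerArrow (k †)

  orth-annihilates : ∀ {K X} (k : Hom K X) → ((orth k) †) ∘ k ≡ zero
  orth-annihilates k = †-zero k (orth k) (proj₁ (ker-isKernel (k †)))

  Closed : ∀ {K X} → Hom K X → Set (o ⊔ ℓ)
  Closed {K} {X} k = ∀ {Z} (x : Hom Z X) → ((orth k) †) ∘ x ≡ zero →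
                     Σ[ y ∈ Hom Z K ] (k ∘ y ≡ x)

  -- Every kernel is closed: if k = ker f then f† factors through k⊥.
  kernel-closed : ∀ {K X} {k : Hom K X} → IsKernel k → Closed k
  kernel-closed {k = k} (_ , _ , f , kerf) x e = kernel-factor kerf x fx
    where
    f†-in-orth : Σ[ t ∈ Hom _ _ ] (orth k ∘ t ≡ f †)
    f†-in-orth = kernel-factor (ker-isKernel (k †)) (f †)
                   (†-zero (f †) k (trans (cong (_∘ k) (†-involutive f)) (proj₁ kerf)))

    fx : f ∘ x ≡ zero
    fx = begin
      f ∘ x          ≡⟨ cong (_∘ x) (sym (†-involutive f)) ⟩
      ((f †) †) ∘ x  ≡⟨ annihilate-through f†-in-orth x e ⟩
      zero           ∎

  closed-kernel : ∀ {K X} {k : Hom K X} → IsDaggerMono k → Closed k → IsKernel k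
  closed-kernel {k = k} dm cl = dm , _ , (orth k †) , (orth-annihilates k , univ)
    where
    univ : ∀ {Z} (g : Hom Z _) → (orth k †) ∘ g ≡ zero →
           Σ[ h ∈ Hom Z _ ] ((k ∘ h ≡ g) × (∀ h' → k ∘ h' ≡ g → h' ≡ h))
    univ g e = proj₁ (cl g e) , proj₂ (cl g e) ,
               λ h' e' → dagger-mono-cancel dm h' _ (trans e' (sym (proj₂ (cl g e))))

  kernel-projection : ∀ {K X Z} {k : Hom K X} → IsKernel k → (x : Hom Z X) →
                      ((orth k) †) ∘ x ≡ zero → k ∘ ((k †) ∘ x) ≡ x
  kernel-projection {k = k} kk x e with kernel-closed kk x e
  ... | y , ky = begin
    k ∘ ((k †) ∘ x)       ≡⟨ cong (λ w → k ∘ ((k †) ∘ w)) (sym ky) ⟩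
    k ∘ ((k †) ∘ (k ∘ y)) ≡⟨ cong (k ∘_) (dagger-retract (proj₁ kk) y) ⟩
    k ∘ y                 ≡⟨ ky ⟩
    x                     ∎

  -- Kernels compose.  If (k ∘ l)⊥† annihilates x then so does k⊥† (as k⊥
  -- factors through (k ∘ l)⊥), so x = k ∘ y; and l⊥† annihilates y (as k ∘ l⊥
  -- factors through (k ∘ l)⊥), so y = l ∘ z.
  kernel-∘ : ∀ {A B C} {k : Hom B C} {l : Hom A B} →
             IsKernel k → IsKernel l → IsKernel (k ∘ l)
  kernel-∘ {B = B} {C} {k} {l} kk kl = closed-kernel (dagger-mono-∘ (proj₁ kk) (proj₁ kl)) closed
    where
    s = orth (k ∘ l)

    k⊥-in-s : Σ[ u ∈ Hom _ _ ] (s ∘ u ≡ orth k)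
    k⊥-in-s = kernel-factor (ker-isKernel ((k ∘ l) †)) (orth k)
                (annihilate-factor k l (orth k) (proj₁ (ker-isKernel (k †))))

    k∘l⊥-in-s : Σ[ u ∈ Hom _ _ ] (s ∘ u ≡ k ∘ orth l)
    k∘l⊥-in-s = kernel-factor (ker-isKernel ((k ∘ l) †)) (k ∘ orth l) (begin
      ((k ∘ l) †) ∘ (k ∘ orth l)     ≡⟨ cong (_∘ (k ∘ orth l)) (†-homo k l) ⟩
      ((l †) ∘ (k †)) ∘ (k ∘ orth l) ≡⟨ assoc _ _ _ ⟩
      (l †) ∘ ((k †) ∘ (k ∘ orth l)) ≡⟨ cong ((l †) ∘_) (dagger-retract (proj₁ kk) (orth l)) ⟩
      (l †) ∘ orth l                 ≡⟨ proj₁ (ker-isKernel (l †)) ⟩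
      zero                           ∎)

    l⊥-annihilates : ∀ {Z} (x : Hom Z C) (y : Hom Z B) → k ∘ y ≡ x → (s †) ∘ x ≡ zero →
                     ((orth l) †) ∘ y ≡ zero
    l⊥-annihilates x y ky e = begin
      ((orth l) †) ∘ y                 ≡⟨ cong ((orth l †) ∘_) (sym (dagger-retract (proj₁ kk) y)) ⟩
      ((orth l) †) ∘ ((k †) ∘ (k ∘ y)) ≡⟨ sym (assoc _ _ _) ⟩
      (((orth l) †) ∘ (k †)) ∘ (k ∘ y) ≡⟨ cong₂ _∘_ (sym (†-homo k (orth l))) ky ⟩
      ((k ∘ orth l) †) ∘ x             ≡⟨ annihilate-through k∘l⊥-in-s x e ⟩
      zero                             ∎

    closed : Closed (k ∘ l)
    closed x e with kernel-closed kk x (annihilate-through k⊥-in-s x e)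
    ... | y , ky with kernel-closed kl y (l⊥-annihilates x y ky e)
    ... | z , lz = z , (begin
      (k ∘ l) ∘ z ≡⟨ assoc k l z ⟩
      k ∘ (l ∘ z) ≡⟨ cong (k ∘_) lz ⟩
      k ∘ y       ≡⟨ ky ⟩
      x           ∎)

  zero-object-factor : ∀ {P A B} → IsZeroObject P → (a : Hom P B) (b : Hom A P) →
                       a ∘ b ≡ zero
  zero-object-factor {P} (initial , _) a b = begin
    a ∘ b              ≡⟨ cong (a ∘_) (sym (identityˡ b)) ⟩
    a ∘ (id ∘ b)       ≡⟨ cong (λ w → a ∘ (w ∘ b)) id≡¡! ⟩
    a ∘ ((¡ ∘ !) ∘ b)  ≡⟨ cong (a ∘_) (assoc ¡ ! b) ⟩
    a ∘ (¡ ∘ (! ∘ b))  ≡⟨ sym (assoc a ¡ (! ∘ b)) ⟩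
    (a ∘ ¡) ∘ (! ∘ b)  ≡⟨ cong₂ _∘_ (¡-unique _) (!-unique _) ⟩
    zero               ∎
    where
    id≡¡! : id {P} ≡ ¡ ∘ !
    id≡¡! = trans (proj₂ initial id) (sym (proj₂ initial (¡ ∘ !)))

  𝟎-isZeroObject : IsZeroObject 𝟎
  𝟎-isZeroObject = (¡ , ¡-unique) , (! , !-unique)

  ¡-isKernel : ∀ {A} → IsKernel (¡ {A})
  ¡-isKernel {A} = trans (¡-unique _) (sym (¡-unique id)) , A , id ,
    (trans (identityˡ ¡) (sym (¡-unique zero)) ,
     λ g e → ! , sym (trans (sym (identityˡ g)) e) , λ h' _ → !-unique h')

  -- If q is the meet of m and n and r is orthogonal to q inside M, then the
  -- meet of m ∘ r and n is zero: every cone factors through the meet q via a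
  -- map h with  q ∘ h = r ∘ a, forcing h = 0 and hence both legs to vanish.
  disjoint-pullback : ∀ {P M N R X} {m : Hom M X} {n : Hom N X} {q : Hom P M}
                      {p : Hom P N} {r : Hom R M} → IsPullback m n q p →
                      IsDaggerMono q → IsDaggerMono r → (q †) ∘ r ≡ zero →
                      IsPullback (m ∘ r) n (¡ {R}) (¡ {N})
  disjoint-pullback {m = m} {n} {q} {p} {r} (_ , meet) dq dr q⊥r =
    trans (¡-unique _) (sym (¡-unique _)) , cone-zero
    where
    cone-zero : ∀ {Z} (a : Hom Z _) (b : Hom Z _) → (m ∘ r) ∘ a ≡ n ∘ b →
                Σ[ h ∈ Hom Z 𝟎 ] ((¡ ∘ h ≡ a) × (¡ ∘ h ≡ b) ×
                  (∀ h' → ¡ ∘ h' ≡ a → ¡ ∘ h' ≡ b → h' ≡ h))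
    cone-zero a b e with meet (r ∘ a) b (trans (sym (assoc m r a)) e)
    ... | h , qh , ph , _ = ! , sym a≡0 , sym b≡0 , (λ h' _ _ → !-unique h')
      where
      h≡0 : h ≡ zero
      h≡0 = begin
        h                ≡⟨ sym (dagger-retract dq h) ⟩
        (q †) ∘ (q ∘ h)  ≡⟨ cong ((q †) ∘_) qh ⟩
        (q †) ∘ (r ∘ a)  ≡⟨ sym (assoc _ _ _) ⟩
        ((q †) ∘ r) ∘ a  ≡⟨ cong (_∘ a) q⊥r ⟩
        zero ∘ a         ≡⟨ ∘-zeroˡ a ⟩
        zero             ∎
      a≡0 : a ≡ zero
      a≡0 = dagger-mono-cancel dr a zero (begin
        r ∘ a     ≡⟨ sym qh ⟩
        q ∘ h     ≡⟨ cong (q ∘_) h≡0 ⟩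
        q ∘ zero  ≡⟨ ∘-zeroʳ q ⟩
        zero      ≡⟨ sym (∘-zeroʳ r) ⟩
        r ∘ zero  ∎)
      b≡0 : b ≡ zero
      b≡0 = trans (sym ph) (trans (cong (p ∘_) h≡0) (∘-zeroʳ p))

  pullbackDagger⇒boolean : PullbackDaggerProperty D → IsBoolean D
  pullbackDagger⇒boolean pd m n q p km kn kq kp pb P≅0 = begin
    (m †) ∘ n       ≡⟨ sym (†-swap n m) ⟩
    ((n †) ∘ m) †   ≡⟨ cong _† (pd m n q p km kn kq kp pb) ⟩
    (p ∘ (q †)) †   ≡⟨ cong _† (zero-object-factor P≅0 p (q †)) ⟩
    zero †          ≡⟨ zero-† ⟩
    zero            ∎

  boolean⇒pullbackDagger : IsBoolean D → PullbackDaggerProperty D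
  boolean⇒pullbackDagger boolean m n q p km kn kq _ pb@(m∘q≡n∘p , _) = begin
    (n †) ∘ m                         ≡⟨ sym (†-swap m n) ⟩
    ((m †) ∘ n) †                     ≡⟨ cong _† (sym (kernel-projection kq ((m †) ∘ n) r⊥m†n)) ⟩
    (q ∘ ((q †) ∘ ((m †) ∘ n))) †     ≡⟨ †-homo q _ ⟩
    (((q †) ∘ ((m †) ∘ n)) †) ∘ (q †) ≡⟨ cong (_∘ (q †)) (trans (†-swap q _) (cong (_∘ q) (†-swap m n))) ⟩
    (((n †) ∘ m) ∘ q) ∘ (q †)         ≡⟨ cong (_∘ (q †)) (assoc _ _ _) ⟩
    ((n †) ∘ (m ∘ q)) ∘ (q †)         ≡⟨ cong (λ w → ((n †) ∘ w) ∘ (q †)) m∘q≡n∘p ⟩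
    ((n †) ∘ (n ∘ p)) ∘ (q †)         ≡⟨ cong (_∘ (q †)) (dagger-retract (proj₁ kn) p) ⟩
    p ∘ (q †)                         ∎
    where
    r = orth q

    m∘r-⊥-n : ((m ∘ r) †) ∘ n ≡ zero
    m∘r-⊥-n = boolean (m ∘ r) n ¡ ¡ (kernel-∘ km (kerArrow-isKernel (q †))) kn
                ¡-isKernel ¡-isKernel
                (disjoint-pullback pb (proj₁ kq) (ker-daggerMono (q †)) (proj₁ (ker-isKernel (q †))))
                𝟎-isZeroObject

    r⊥m†n : (r †) ∘ ((m †) ∘ n) ≡ zero
    r⊥m†n = begin
      (r †) ∘ ((m †) ∘ n)  ≡⟨ sym (assoc _ _ _) ⟩
      ((r †) ∘ (m †)) ∘ n  ≡⟨ cong (_∘ n) (sym (†-homo m r)) ⟩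
      ((m ∘ r) †) ∘ n      ≡⟨ m∘r-⊥-n ⟩
      zero                 ∎

proposition6p4 : ∀ {o ℓ : Level} (D : DaggerKernelCategory o ℓ) →
    IsBoolean D ⇔ PullbackDaggerProperty D
proposition6p4 D = mk⇔ boolean⇒pullbackDagger pullbackDagger⇒boolean
  where open KernelFacts D
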